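{- Let $d \ge 2$ and let $G$ be an Eulerian $d$-sphere. Then for every vertex $x$ of $G$, the unit sphere $S(x)$ is an Eulerian $(d-1)$-sphere.
   Context: All graphs are finite simple graphs. For a vertex $x$, $S(x)$ is the subgraph induced by the neighbors of $x$. Contractibility: $K_1$ is contractible, and $G$ is contractible if it has a vertex $x$ with $S(x)$ and $G-\{x\}$ both contractible. Spheres: $\mathcal{S}_{ -1}=\{\emptyset\}$; for $d\ge0$, $G\in\mathcal{S}_d$ if $S(x)\in\mathcal{S}_{d-1}$ for all vertices $x$ and $G-\{v\}$ is contractible for some vertex $v$. An Eulerian $d$-sphere is a graph in $\mathcal{S}_d$ with chromatic number $d+1$. -}

module Defs where

open import Data.Nat using (ℕ; zero; suc)
open import Data.Bool using (Bool; true; false)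
open import Data.Fin using (Fin)
open import Data.Fin.Subset using (Subset; _∈_; _∩_; _-_; ∣_∣; ⊤)
open import Data.Vec using (tabulate)
open import Data.Product using (Σ; ∃; _×_)
open import Relation.Nullary using (¬_)
open import Relation.Binary.PropositionalEquality using (_≡_; _≢_)

record Graph (n : ℕ) : Set where
  field
    adj   : Fin n → Fin n → Bool
    sym   : ∀ x y → adj x y ≡ adj y x
    irrefl : ∀ x → adj x x ≡ false

open Graph public

module _ {n : ℕ} (G : Graph n) where

  -- Neighbourhood of x (as a vertex subset). For an induced subgraph on U,
  -- the unit sphere S(x) is the subgraph induced on  U ∩ N x.
  N : Fin n → Subset n
  N x = tabulate (adj G x)

  data Contractible : Subset n → Set where
    k1   : ∀ {U} → ∣ U ∣ ≡ 1 → Contractible U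
    step : ∀ {U} x → x ∈ U → Contractible (U ∩ N x) → Contractible (U - x)
         → Contractible U

  -- Sph k U  means  G[U] ∈ 𝒮_(k-1).
  --   𝒮_(-1) = {∅};
  --   for d ≥ 0: every unit sphere is in 𝒮_(d-1), and G[U] - {v} is
  --   contractible for some vertex v.
  Sph : ℕ → Subset n → Set
  Sph zero    U = ∣ U ∣ ≡ 0
  Sph (suc k) U = (∀ x → x ∈ U → Sph k (U ∩ N x))
                × (∃ λ v → v ∈ U × Contractible (U - v))

  IsSphere : ℕ → Subset n → Set
  IsSphere d U = Sph (suc d) U

  ProperColouring : ℕ → Subset n → Set
  ProperColouring k U =
    Σ (Fin n → Fin k) λ c →
      ∀ x y → x ∈ U → y ∈ U → adj G x y ≡ true → c x ≢ c y

  ChromaticNumber : Subset n → ℕ → Set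
  ChromaticNumber U zero    = ProperColouring zero U
  ChromaticNumber U (suc k) = ProperColouring (suc k) U × ¬ ProperColouring k U

  EulerianSphere : ℕ → Subset n → Set
  EulerianSphere d U = IsSphere d U × ChromaticNumber U (suc d)

module Submission where

-- Three independent facts give the theorem.
--  * Sphere part: by definition a vertex's unit sphere in a d-sphere is a
--    (d-1)-sphere; only ⊤ ∩ N x ≡ N x has to be transported.
--  * Lower bound on colours: every k-sphere contains a (k+1)-clique (pick a
--    vertex and recurse into its unit sphere), and by the pigeonhole
--    principle a clique with more vertices than colours cannot be properly
--    coloured.  So a (d-1)-sphere is never (d-1)-colourable.
--  * Upper bound on colours: in a proper (k+2)-colouring c, every neighbour y
--    of x has c y ≠ c x, so deleting the colour c x (via punchOut) turns c
--    into a proper (k+1)-colouring of the unit sphere S(x).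

open import Defs
open import Data.Nat using (ℕ; _≤_; _<_; _∸_; zero; suc; s≤s; z≤n)
open import Data.Nat.Properties using (n<1+n)
open import Data.Fin using (Fin; _≟_; punchOut)
open import Data.Fin.Subset using (⊤; Subset; _∈_; _∩_)
open import Data.Fin.Subset.Properties using (∈⊤; x∈p∩q⁻; ∩-identityˡ)
open import Data.Fin.Properties using (pigeonhole; punchOut-injective; <⇒≢)
open import Data.Vec.Properties using ([]=⇒lookup; lookup∘tabulate)
open import Data.Bool using (true)
open import Data.Product using (Σ; _×_; _,_; proj₁; proj₂)
open import Relation.Nullary using (¬_; yes; no; contradiction)
open import Relation.Binary.PropositionalEquality
  using (_≡_; _≢_; refl; trans; subst; cong)
  renaming (sym to ≡-sym)

-- Deleting one colour a from a palette of k+2 colours: every other colour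
-- is renumbered injectively into k+1 colours (a itself goes anywhere).
deleteColour : ∀ {k} → Fin (suc (suc k)) → Fin (suc (suc k)) → Fin (suc k)
deleteColour a b with a ≟ b
... | yes _   = Fin.zero
... | no  a≢b = punchOut a≢b

deleteColour-injective : ∀ {k} {a b b′ : Fin (suc (suc k))} → a ≢ b → a ≢ b′
                       → deleteColour a b ≡ deleteColour a b′ → b ≡ b′
deleteColour-injective {a = a} {b} {b′} a≢b a≢b′ eq with a ≟ b | a ≟ b′
... | yes a≡b | _        = contradiction a≡b a≢b
... | no  _   | yes a≡b′ = contradiction a≡b′ a≢b′
... | no  p   | no  p′   = punchOut-injective p p′ eq

module _ {n : ℕ} (G : Graph n) where

  ∈N⇒adj : ∀ {x y} → y ∈ N G x → adj G x y ≡ true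
  ∈N⇒adj {x} {y} y∈Nx = trans (≡-sym (lookup∘tabulate (adj G x) y)) ([]=⇒lookup y∈Nx)

  Clique : ℕ → Subset n → Set
  Clique k U = Σ (Fin k → Fin n) λ h →
    (∀ i → h i ∈ U) × (∀ i j → i ≢ j → adj G (h i) (h j) ≡ true)

  emptyClique : ∀ U → Clique zero U
  emptyClique U = (λ ()) , (λ ()) , λ ()

  extendClique : ∀ {k U v} → v ∈ U → Clique k (U ∩ N G v) → Clique (suc k) U
  extendClique {k} {U} {v} v∈U (h , h∈ , h-adj) = h⁺ , h⁺∈U , h⁺-adj
    where
    h⁺ : Fin (suc k) → Fin n
    h⁺ Fin.zero    = v
    h⁺ (Fin.suc i) = h i

    h∈U : ∀ i → h i ∈ U
    h∈U i = proj₁ (x∈p∩q⁻ U (N G v) (h∈ i))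

    v-adj-h : ∀ i → adj G v (h i) ≡ true
    v-adj-h i = ∈N⇒adj (proj₂ (x∈p∩q⁻ U (N G v) (h∈ i)))

    h⁺∈U : ∀ i → h⁺ i ∈ U
    h⁺∈U Fin.zero    = v∈U
    h⁺∈U (Fin.suc i) = h∈U i

    h⁺-adj : ∀ i j → i ≢ j → adj G (h⁺ i) (h⁺ j) ≡ true
    h⁺-adj Fin.zero    Fin.zero    i≢j = contradiction refl i≢j
    h⁺-adj Fin.zero    (Fin.suc j) _   = v-adj-h j
    h⁺-adj (Fin.suc i) Fin.zero    _   = trans (Graph.sym G (h i) v) (v-adj-h i)
    h⁺-adj (Fin.suc i) (Fin.suc j) i≢j = h-adj i j (λ i≡j → i≢j (cong Fin.suc i≡j))

  sphereClique : ∀ k {U} → Sph G (suc k) U → Clique (suc k) U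
  sphereClique zero    {U} (_ , v , v∈U , _) = extendClique v∈U (emptyClique (U ∩ N G v))
  sphereClique (suc k)     (unitSpheres , v , v∈U , _) =
    extendClique v∈U (sphereClique k (unitSpheres v v∈U))

  clique⇒¬colouring : ∀ {j k U} → j < k → Clique k U → ¬ ProperColouring G j U
  clique⇒¬colouring j<k (h , h∈ , h-adj) (c , proper)
    with pigeonhole j<k (λ i → c (h i))
  ... | i , i′ , i<i′ , same =
    proper (h i) (h i′) (h∈ i) (h∈ i′) (h-adj i i′ (<⇒≢ i<i′)) same

  sphere⇒¬colouring : ∀ k {U} → Sph G (suc k) U → ¬ ProperColouring G k U
  sphere⇒¬colouring k sphere = clique⇒¬colouring (n<1+n k) (sphereClique k sphere)

  unitSphereColouring : ∀ {k U x} → x ∈ U → ProperColouring G (suc (suc k)) U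
                      → ProperColouring G (suc k) (U ∩ N G x)
  unitSphereColouring {U = U} {x} x∈U (c , proper) = c′ , proper′
    where
    c′ : Fin n → Fin _
    c′ y = deleteColour (c x) (c y)

    inU : ∀ {y} → y ∈ U ∩ N G x → y ∈ U
    inU {y} y∈ = proj₁ (x∈p∩q⁻ U (N G x) y∈)

    differsFromCentre : ∀ {y} → y ∈ U ∩ N G x → c x ≢ c y
    differsFromCentre {y} y∈ =
      proper x y x∈U (inU y∈) (∈N⇒adj (proj₂ (x∈p∩q⁻ U (N G x) y∈)))

    proper′ : ∀ y z → y ∈ U ∩ N G x → z ∈ U ∩ N G x → adj G y z ≡ true → c′ y ≢ c′ z
    proper′ y z y∈ z∈ y~z same = proper y z (inU y∈) (inU z∈) y~z
      (deleteColour-injective (differsFromCentre y∈) (differsFromCentre z∈) same)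

mainTheorem2 : ∀ {n : ℕ} (G : Graph n) (d : ℕ) → 2 ≤ d
    → EulerianSphere G d ⊤
    → ∀ (x : Fin n) → EulerianSphere G (d ∸ 1) (N G x)
mainTheorem2 G (suc (suc e)) (s≤s (s≤s z≤n)) ((unitSpheres , _) , (colouring , _)) x =
  unitSphere , (colouringS , sphere⇒¬colouring G (suc e) unitSphere)
  where
  toNx : ∀ (A : Subset _ → Set) → A (⊤ ∩ N G x) → A (N G x)
  toNx A = subst A (∩-identityˡ (N G x))

  unitSphere : Sph G (suc (suc e)) (N G x)
  unitSphere = toNx (Sph G (suc (suc e))) (unitSpheres x ∈⊤)

  colouringS : ProperColouring G (suc (suc e)) (N G x)
  colouringS = toNx (ProperColouring G (suc (suc e))) (unitSphereColouring G ∈⊤ colouring)
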